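{- Let $n,a,b,t$ be integers with $n\ge 1$, $t\ge 1$. Then $M\le N_{prod}(n,a,b,t)\le n^3\cdot M$, where $$M=\max_{\substack{u,v,s\in[n]\\ u+v\ge s+t}}\binom{s}{u}\binom{n-s}{a-u}\binom{s}{v}\binom{n-s}{b-v}.$$
   Context: $\binom{[n]}{m}$ denotes the set of all $m$-element subsets of $[n]=\{1,\dots,n\}$. A family $\mathcal{F}$ of subsets of $[n]$ is $m$-uniform if $\mathcal{F}\subseteq\binom{[n]}{m}$. Families $\mathcal{F},\mathcal{G}$ are cross-$t$-intersecting if $|F\cap G|\ge t$ for all $F\in\mathcal{F},G\in\mathcal{G}$. $N_{prod}(n,a,b,t)$ is the maximum of $|\mathcal{F}|\cdot|\mathcal{G}|$ over all pairs with $\mathcal{F}$ $a$-uniform, $\mathcal{G}$ $b$-uniform, and $\mathcal{F},\mathcal{G}$ cross-$t$-intersecting. Binomial coefficients $\binom{x}{y}$ are $0$ when $y<0$ or $y>x$. -}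

module Defs where

open import Data.Nat using (ℕ; zero; suc; _+_; _*_; _∸_; _≤_; _⊔_; _≤ᵇ_)
open import Data.Nat.Combinatorics using (_C_)
open import Data.Integer using (ℤ; +_; -[1+_]; _-_)
open import Data.Bool using (if_then_else_)
open import Data.List using (List; length; map; foldr; upTo; concatMap)
open import Data.List.Relation.Unary.All using (All)
open import Data.List.Relation.Unary.Unique.Propositional using (Unique)
open import Data.List.Membership.Propositional using (_∈_)
open import Data.Fin.Subset using (Subset; _∩_; ∣_∣)
open import Data.Product using (_×_)
open import Relation.Binary.PropositionalEquality using (_≡_)

-- binomial coefficient with an integer lower argument: 0 if k < 0,
-- and (n C k) = 0 for k > n (stdlib convention)
binomℤ : ℕ → ℤ → ℕ
binomℤ n (+ k)      = n C k
binomℤ n -[1+ k ]   = 0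

range1 : ℕ → List ℕ
range1 n = map suc (upTo n)

-- a family of subsets of [n]: a duplicate-free list of subsets; |𝓕| = length
Family : ℕ → Set
Family n = List (Subset n)

Uniform : {n : ℕ} → ℤ → Family n → Set
Uniform m 𝓕 = All (λ F → + ∣ F ∣ ≡ m) 𝓕

CrossInt : {n : ℕ} → ℕ → Family n → Family n → Set
CrossInt t 𝓕 𝓖 = ∀ {F G} → F ∈ 𝓕 → G ∈ 𝓖 → t ≤ ∣ F ∩ G ∣

-- admissible pair for N_prod(n,a,b,t)
Admissible : (n : ℕ) → ℤ → ℤ → ℕ → Family n → Family n → Set
Admissible n a b t 𝓕 𝓖 =
  Unique 𝓕 × Unique 𝓖 × Uniform a 𝓕 × Uniform b 𝓖 × CrossInt t 𝓕 𝓖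

term : ℕ → ℤ → ℤ → ℕ → ℕ → ℕ → ℕ
term n a b u v s =
  (s C u) * binomℤ (n ∸ s) (a - + u) * (s C v) * binomℤ (n ∸ s) (b - + v)

maxList : List ℕ → ℕ
maxList = foldr _⊔_ 0

-- M = max over u,v,s ∈ [n] with u+v ≥ s+t (0 if no such triple)
M : ℕ → ℤ → ℤ → ℕ → ℕ
M n a b t = maxList (concatMap (λ s → concatMap (λ u → map (λ v →
  if (s + t) ≤ᵇ (u + v) then term n a b u v s else 0) (range1 n)) (range1 n)) (range1 n))

-- Lower bound: for s ≤ n and u + v ≥ s + t, the a-sets meeting [s] in exactly u points and the
-- b-sets meeting [s] in exactly v points are cross-t-intersecting, since two of them share at
-- least u + v − s ≥ t points of [s]; the product of their numbers is a term of M.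
-- Upper bound: the shift S_ij (replace j by i < j in a member wherever the result is new),
-- applied to both families at once, preserves sizes, uniformity and cross-t-intersection and
-- lowers the total index weight of 𝓕, so we may assume 𝓕 shifted. Then any A ∈ 𝓕, B ∈ 𝓖 have a
-- prefix [s] with |A ∩ [s]| + |B ∩ [s]| ≥ s + t: otherwise a common element of A and B can be
-- moved to an earlier position outside A ∪ B, which stays in 𝓕, still has no such prefix and
-- meets B in one point less, until |A ∩ B| < t. So 𝓕 × 𝓖 is covered by n³ products of such
-- layers, each of size at most M.

module Submission where

open import Defs
open import Data.Bool using (Bool; true; false; _∧_; T; if_then_else_)
import Data.Bool.Properties as Bool
open import Data.Fin using (Fin; zero; suc; toℕ; _≟_)
open import Data.Fin.Subset using (Subset; _∩_; ∣_∣)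
open import Data.Fin.Subset.Properties using (∩-comm)
open import Data.Integer as ℤ using (ℤ)
import Data.Integer.Properties as ℤ
open import Data.List using (List; []; _∷_; [_]; map; length; _++_; concatMap; cartesianProduct; upTo)
open import Data.List.Properties using (length-map; length-++; length-upTo; length-removeAt′)
open import Data.List.Membership.Propositional using (_∈_; _∉_; _─_; find)
open import Data.List.Membership.Propositional.Properties
  using ( ∈-map⁺; ∈-map⁻; ∈-++⁺ˡ; ∈-++⁺ʳ; ∈-++⁻; ∈-concatMap⁺; ∈-concatMap⁻
        ; ∈-cartesianProduct⁺; ∈-cartesianProduct⁻; ∈-upTo⁺; ∈-upTo⁻)
open import Data.List.Relation.Binary.Subset.Propositional using (_⊆_)
open import Data.List.Relation.Unary.All as All using (All; [])
import Data.List.Relation.Unary.All.Properties as All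
open import Data.List.Relation.Unary.Any as Any using (here; there)
open import Data.List.Relation.Unary.AllPairs using ([]; _∷_)
open import Data.List.Relation.Unary.Unique.Propositional using (Unique)
import Data.List.Relation.Unary.Unique.Propositional.Properties as Unique
open import Data.Nat.Combinatorics using (_C_; nCk+nC[k+1]≡[n+1]C[k+1]; k>n⇒nCk≡0)
open import Data.Nat using (ℕ; zero; suc; _+_; _*_; _∸_; _^_; _≤_; _<_; _≤ᵇ_; z≤n; s≤s; _<?_)
open import Data.Nat.ListAction using (sum)
open import Data.Nat.Properties hiding (_≟_)
open import Data.Nat.Tactic.RingSolver using (solve-∀)
open import Algebra.Properties.CommutativeSemigroup +-commutativeSemigroup using (xy∙z≈xz∙y; xy∙z≈zy∙x)
open import Data.Product using (Σ; ∃; _×_; _,_; proj₁; proj₂)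
open import Data.Sum using (_⊎_; inj₁; inj₂)
open import Data.Empty using (⊥; ⊥-elim)
open import Data.Vec using ([]; _∷_; lookup; _[_]≔_)
import Data.Vec.Properties as Vec
open import Function using (_∘_; const)
open import Relation.Binary.PropositionalEquality hiding ([_])
open import Relation.Nullary using (¬_; Dec; yes; no)
open import Relation.Nullary.Negation using (contradiction)

Fin-∀⊎∃ : ∀ {n} {P Q : Fin n → Set} → (∀ i → P i ⊎ Q i) → (∀ i → P i) ⊎ ∃ Q
Fin-∀⊎∃ {zero}  _ = inj₁ (λ ())
Fin-∀⊎∃ {suc n} {P} {Q} P⊎Q with P⊎Q zero | Fin-∀⊎∃ {P = P ∘ suc} {Q = Q ∘ suc} (P⊎Q ∘ suc)
... | inj₂ q₀ | _             = inj₂ (zero , q₀)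
... | inj₁ p₀ | inj₁ p        = inj₁ λ { zero → p₀ ; (suc i) → p i }
... | inj₁ _  | inj₂ (i , q)  = inj₂ (suc i , q)

List-∀⊎∃ : ∀ {X : Set} {P Q : X → Set} (xs : List X) → (∀ x → P x ⊎ Q x) →
  (∀ {x} → x ∈ xs → P x) ⊎ ∃ (λ x → x ∈ xs × Q x)
List-∀⊎∃ []       _ = inj₁ (λ ())
List-∀⊎∃ {P = P} {Q} (x ∷ xs) P⊎Q with P⊎Q x | List-∀⊎∃ {P = P} {Q} xs P⊎Q
... | inj₂ qx | _                  = inj₂ (x , here refl , qx)
... | inj₁ px | inj₁ p             = inj₁ λ { (here refl) → px ; (there y∈) → p y∈ }
... | inj₁ _  | inj₂ (y , y∈ , qy) = inj₂ (y , there y∈ , qy)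

Unique-map-injectiveOn : ∀ {X Y : Set} {f : X → Y} {xs : List X} →
  (∀ {x y} → x ∈ xs → y ∈ xs → f x ≡ f y → x ≡ y) → Unique xs → Unique (map f xs)
Unique-map-injectiveOn {xs = []}     _   []         = []
Unique-map-injectiveOn {xs = x ∷ xs} inj (x∉ ∷ uxs) =
  All.map⁺ (All.tabulate (λ y∈xs → All.lookup x∉ y∈xs ∘ inj (here refl) (there y∈xs)))
  ∷ Unique-map-injectiveOn (λ x∈ y∈ → inj (there x∈) (there y∈)) uxs

sum-map-≤ : ∀ {X : Set} (g : X → ℕ) (f : X → X) xs → (∀ x → g (f x) ≤ g x) →
  sum (map g (map f xs)) ≤ sum (map g xs)
sum-map-≤ g f []       _    = z≤n
sum-map-≤ g f (x ∷ xs) g∘f≤ = +-mono-≤ (g∘f≤ x) (sum-map-≤ g f xs g∘f≤)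

sum-map-< : ∀ {X : Set} (g : X → ℕ) (f : X → X) xs → (∀ x → g (f x) ≤ g x) →
  ∀ {x} → x ∈ xs → g (f x) < g x → sum (map g (map f xs)) < sum (map g xs)
sum-map-< g f (x ∷ xs) g∘f≤ (here refl) g∘fx< = +-mono-<-≤ g∘fx< (sum-map-≤ g f xs g∘f≤)
sum-map-< g f (x ∷ xs) g∘f≤ (there y∈)  g∘fy< = +-mono-≤-< (g∘f≤ x) (sum-map-< g f xs g∘f≤ y∈ g∘fy<)

∈-─ : ∀ {X : Set} {x z : X} {ys} (x∈ : x ∈ ys) → z ∈ ys → x ≢ z → z ∈ ys ─ x∈
∈-─ (here refl) (here refl) x≢z = contradiction refl x≢z
∈-─ (here refl) (there z∈)  _   = z∈
∈-─ (there x∈)  (here refl) _   = here refl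
∈-─ (there x∈)  (there z∈)  x≢z = there (∈-─ x∈ z∈ x≢z)

Unique⇒length≤ : ∀ {X : Set} {xs ys : List X} → Unique xs → xs ⊆ ys → length xs ≤ length ys
Unique⇒length≤ {xs = []}               _          _   = z≤n
Unique⇒length≤ {xs = x ∷ xs} {ys = ys} (x∉ ∷ uxs) xs⊆ = begin
  suc (length xs)            ≤⟨ s≤s (Unique⇒length≤ uxs (λ z∈ → ∈-─ x∈ys (xs⊆ (there z∈)) (All.lookup x∉ z∈))) ⟩
  suc (length (ys ─ x∈ys))   ≡⟨ length-removeAt′ ys (Any.index x∈ys) ⟨
  length ys                  ∎
  where
  open ≤-Reasoning
  x∈ys = xs⊆ (here refl)

length-cartesianProduct : ∀ {X Y : Set} (xs : List X) (ys : List Y) →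
  length (cartesianProduct xs ys) ≡ length xs * length ys
length-cartesianProduct []       ys = refl
length-cartesianProduct (x ∷ xs) ys = trans (length-++ (map (x ,_) ys))
  (cong₂ _+_ (length-map (x ,_) ys) (length-cartesianProduct xs ys))

length-concatMap≤ : ∀ {X Y : Set} (f : X → List Y) xs {m} → (∀ {x} → x ∈ xs → length (f x) ≤ m) →
  length (concatMap f xs) ≤ length xs * m
length-concatMap≤ f []       _     = z≤n
length-concatMap≤ f (x ∷ xs) ≤m = begin
  length (f x ++ concatMap f xs)           ≡⟨ length-++ (f x) ⟩
  length (f x) + length (concatMap f xs)   ≤⟨ +-mono-≤ (≤m (here refl)) (length-concatMap≤ f xs (≤m ∘ there)) ⟩
  _ + length xs * _                        ∎
  where open ≤-Reasoning

∈-concatMap⁺′ : ∀ {X Y : Set} (f : X → List Y) {x y xs} → x ∈ xs → y ∈ f x → y ∈ concatMap f xs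
∈-concatMap⁺′ f x∈ y∈ = ∈-concatMap⁺ f (Any.map (λ { refl → y∈ }) x∈)

∈-concatMap⁻′ : ∀ {X Y : Set} (f : X → List Y) {y} xs → y ∈ concatMap f xs → ∃ λ x → x ∈ xs × y ∈ f x
∈-concatMap⁻′ f xs y∈ = find (∈-concatMap⁻ f y∈)

≤-maxList : ∀ {x xs} → x ∈ xs → x ≤ maxList xs
≤-maxList {xs = y ∷ ys} (here refl) = m≤m⊔n y (maxList ys)
≤-maxList {xs = y ∷ ys} (there x∈)  = ≤-trans (≤-maxList x∈) (m≤n⊔m y (maxList ys))

maxList-attained : ∀ xs → maxList xs ≡ 0 ⊎ ∃ λ x → x ∈ xs × maxList xs ≡ x
maxList-attained []       = inj₁ refl
maxList-attained (x ∷ xs) with ⊔-sel x (maxList xs)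
... | inj₁ max≡x = inj₂ (x , here refl , max≡x)
... | inj₂ max≡rest with maxList-attained xs
...   | inj₁ rest≡0          = inj₁ (trans max≡rest rest≡0)
...   | inj₂ (y , y∈ , rest≡y) = inj₂ (y , there y∈ , trans max≡rest rest≡y)

∈-range1 : ∀ {n s} → 1 ≤ s → s ≤ n → s ∈ range1 n
∈-range1 {s = suc s} _ s≤n = ∈-map⁺ suc (∈-upTo⁺ s≤n)

∈-range1⁻ : ∀ {n s} → s ∈ range1 n → s ≤ n
∈-range1⁻ s∈ with ∈-map⁻ suc s∈
... | _ , k∈ , refl = ∈-upTo⁻ k∈

length-range1 : ∀ n → length (range1 n) ≡ n
length-range1 n = trans (length-map suc (upTo n)) (length-upTo n)

m-n≡+w⇒m≡+[n+w] : ∀ (m : ℤ) n w → m ℤ.- ℤ.+ n ≡ ℤ.+ w → m ≡ ℤ.+ (n + w)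
m-n≡+w⇒m≡+[n+w] m n w m-n≡w = begin
  m                                 ≡⟨ ℤ.+-identityʳ m ⟨
  m ℤ.+ ℤ.+ 0                       ≡⟨ cong (λ z → m ℤ.+ z) (ℤ.+-inverseˡ (ℤ.+ n)) ⟨
  m ℤ.+ (ℤ.- ℤ.+ n ℤ.+ ℤ.+ n)       ≡⟨ ℤ.+-assoc m (ℤ.- ℤ.+ n) (ℤ.+ n) ⟨
  (m ℤ.- ℤ.+ n) ℤ.+ ℤ.+ n           ≡⟨ cong (ℤ._+ ℤ.+ n) m-n≡w ⟩
  ℤ.+ (w + n)                       ≡⟨ cong ℤ.+_ (+-comm w n) ⟩
  ℤ.+ (n + w)                       ∎
  where open ≡-Reasoning

pick : Bool → ℕ → ℕ
pick true  x = x
pick false x = 0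

⟦_⟧ : Bool → ℕ
⟦ b ⟧ = pick b 1

weight : ∀ {n} → (Fin n → ℕ) → Subset n → ℕ
weight w []      = 0
weight w (b ∷ X) = pick b (w zero) + weight (w ∘ suc) X

∣∣≡weight1 : ∀ {n} (X : Subset n) → ∣ X ∣ ≡ weight (const 1) X
∣∣≡weight1 []          = refl
∣∣≡weight1 (true ∷ X)  = cong suc (∣∣≡weight1 X)
∣∣≡weight1 (false ∷ X) = ∣∣≡weight1 X

lookup-ext : ∀ {n} (X Y : Subset n) → (∀ i → lookup X i ≡ lookup Y i) → X ≡ Y
lookup-ext X Y eq = trans (sym (Vec.tabulate∘lookup X)) (trans (Vec.tabulate-cong eq) (Vec.tabulate∘lookup Y))

weight-update : ∀ {n} (w : Fin n → ℕ) (X : Subset n) i b →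
  weight w (X [ i ]≔ b) + pick (lookup X i) (w i) ≡ weight w X + pick b (w i)
weight-update w (x ∷ X) zero b = xy∙z≈zy∙x (pick b (w zero)) (weight (w ∘ suc) X) (pick x (w zero))
weight-update w (x ∷ X) (suc i) b = begin
    pick x (w zero) + weight (w ∘ suc) (X [ i ]≔ b) + pick (lookup X i) (w (suc i))
      ≡⟨ +-assoc (pick x (w zero)) _ _ ⟩
    pick x (w zero) + (weight (w ∘ suc) (X [ i ]≔ b) + pick (lookup X i) (w (suc i)))
      ≡⟨ cong (pick x (w zero) +_) (weight-update (w ∘ suc) X i b) ⟩
    pick x (w zero) + (weight (w ∘ suc) X + pick b (w (suc i)))
      ≡⟨ +-assoc (pick x (w zero)) _ _ ⟨
    pick x (w zero) + weight (w ∘ suc) X + pick b (w (suc i)) ∎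
  where open ≡-Reasoning

AgreeOff : ∀ {n} → Fin n → Fin n → Subset n → Subset n → Set
AgreeOff i j X Y = ∀ k → k ≢ i → k ≢ j → lookup X k ≡ lookup Y k

agreeOff-ext : ∀ {n} {i j : Fin n} (X Y : Subset n) → AgreeOff i j X Y →
  lookup X i ≡ lookup Y i → lookup X j ≡ lookup Y j → X ≡ Y
agreeOff-ext {i = i} {j} X Y agree Xᵢ≡Yᵢ Xⱼ≡Yⱼ = lookup-ext X Y pointwise
  where
  pointwise : ∀ k → lookup X k ≡ lookup Y k
  pointwise k with k ≟ i | k ≟ j
  ... | yes refl | _        = Xᵢ≡Yᵢ
  ... | no _     | yes refl = Xⱼ≡Yⱼ
  ... | no k≢i   | no k≢j   = agree k k≢i k≢j

weight-agreeOff : ∀ {n} (w : Fin n → ℕ) {i j : Fin n} (X Y : Subset n) → i ≢ j → AgreeOff i j X Y →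
  ∀ {xᵢ xⱼ yᵢ yⱼ} → lookup X i ≡ xᵢ → lookup X j ≡ xⱼ → lookup Y i ≡ yᵢ → lookup Y j ≡ yⱼ →
  weight w X + pick yᵢ (w i) + pick yⱼ (w j) ≡ weight w Y + pick xᵢ (w i) + pick xⱼ (w j)
weight-agreeOff w {i} {j} X Y i≢j agree refl refl refl refl = begin
    weight w X + yᵢ + yⱼ           ≡⟨ cong (_+ yⱼ) (weight-update w X i (lookup Y i)) ⟨
    weight w X′ + xᵢ + yⱼ          ≡⟨ xy∙z≈xz∙y (weight w X′) xᵢ yⱼ ⟩
    weight w X′ + yⱼ + xᵢ          ≡⟨ cong (_+ xᵢ) (weight-update w X′ j (lookup Y j)) ⟨
    weight w X″ + x′ⱼ + xᵢ         ≡⟨ cong₂ (λ Z b → weight w Z + pick b (w j) + xᵢ) X″≡Y x′ⱼ≡xⱼ ⟩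
    weight w Y + xⱼ + xᵢ           ≡⟨ xy∙z≈xz∙y (weight w Y) xⱼ xᵢ ⟩
    weight w Y + xᵢ + xⱼ           ∎
  where
  open ≡-Reasoning
  X′ = X [ i ]≔ lookup Y i
  X″ = X′ [ j ]≔ lookup Y j
  xᵢ = pick (lookup X i) (w i)
  xⱼ = pick (lookup X j) (w j)
  yᵢ = pick (lookup Y i) (w i)
  yⱼ = pick (lookup Y j) (w j)
  x′ⱼ = pick (lookup X′ j) (w j)
  x′ⱼ≡xⱼ : lookup X′ j ≡ lookup X j
  x′ⱼ≡xⱼ = Vec.lookup∘update′ (i≢j ∘ sym) X (lookup Y i)
  X″≡Y : X″ ≡ Y
  X″≡Y = agreeOff-ext X″ Y
    (λ k k≢i k≢j → trans (Vec.lookup∘update′ k≢j X′ (lookup Y j))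
                         (trans (Vec.lookup∘update′ k≢i X (lookup Y i)) (agree k k≢i k≢j)))
    (trans (Vec.lookup∘update′ i≢j X′ (lookup Y j)) (Vec.lookup∘update i X (lookup Y i)))
    (Vec.lookup∘update j X′ (lookup Y j))

card-agreeOff : ∀ {n} {i j : Fin n} (X Y : Subset n) → i ≢ j → AgreeOff i j X Y →
  ∀ {xᵢ xⱼ yᵢ yⱼ} → lookup X i ≡ xᵢ → lookup X j ≡ xⱼ → lookup Y i ≡ yᵢ → lookup Y j ≡ yⱼ →
  ∣ X ∣ + ⟦ yᵢ ⟧ + ⟦ yⱼ ⟧ ≡ ∣ Y ∣ + ⟦ xᵢ ⟧ + ⟦ xⱼ ⟧
card-agreeOff X Y i≢j agree
  rewrite ∣∣≡weight1 X | ∣∣≡weight1 Y = weight-agreeOff (const 1) X Y i≢j agree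

lookup-∩ : ∀ {n} (X Y : Subset n) k → lookup (X ∩ Y) k ≡ lookup X k ∧ lookup Y k
lookup-∩ X Y k = Vec.lookup-zipWith _∧_ k X Y

swap : ∀ {n} → Fin n → Fin n → Subset n → Subset n
swap i j A = (A [ i ]≔ lookup A j) [ j ]≔ lookup A i

module _ {n} {i j : Fin n} (i≢j : i ≢ j) where

  lookup-swap-i : ∀ A → lookup (swap i j A) i ≡ lookup A j
  lookup-swap-i A = trans (Vec.lookup∘update′ i≢j (A [ i ]≔ lookup A j) (lookup A i))
                          (Vec.lookup∘update i A (lookup A j))

  lookup-swap-j : ∀ A → lookup (swap i j A) j ≡ lookup A i
  lookup-swap-j A = Vec.lookup∘update j (A [ i ]≔ lookup A j) (lookup A i)

  swap-agreeOff : ∀ A → AgreeOff i j (swap i j A) A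
  swap-agreeOff A k k≢i k≢j = trans (Vec.lookup∘update′ k≢j (A [ i ]≔ lookup A j) (lookup A i))
                                    (Vec.lookup∘update′ k≢i A (lookup A j))

  swap-involutive : ∀ A → swap i j (swap i j A) ≡ A
  swap-involutive A = agreeOff-ext _ A
    (λ k k≢i k≢j → trans (swap-agreeOff (swap i j A) k k≢i k≢j) (swap-agreeOff A k k≢i k≢j))
    (trans (lookup-swap-i (swap i j A)) (lookup-swap-j A))
    (trans (lookup-swap-j (swap i j A)) (lookup-swap-i A))

  swap-id : ∀ A → lookup A i ≡ lookup A j → swap i j A ≡ A
  swap-id A Aᵢ≡Aⱼ = agreeOff-ext _ A (swap-agreeOff A)
    (trans (lookup-swap-i A) (sym Aᵢ≡Aⱼ)) (trans (lookup-swap-j A) Aᵢ≡Aⱼ)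

  swap-∩ : ∀ A B → swap i j (A ∩ B) ≡ swap i j A ∩ swap i j B
  swap-∩ A B = agreeOff-ext _ _
    (λ k k≢i k≢j → trans (swap-agreeOff (A ∩ B) k k≢i k≢j)
      (entries k (sym (swap-agreeOff A k k≢i k≢j)) (sym (swap-agreeOff B k k≢i k≢j))))
    (trans (lookup-swap-i (A ∩ B)) (entries i (sym (lookup-swap-i A)) (sym (lookup-swap-i B))))
    (trans (lookup-swap-j (A ∩ B)) (entries j (sym (lookup-swap-j A)) (sym (lookup-swap-j B))))
    where
    entries : ∀ {l} k → lookup A l ≡ lookup (swap i j A) k → lookup B l ≡ lookup (swap i j B) k →
      lookup (A ∩ B) l ≡ lookup (swap i j A ∩ swap i j B) k
    entries {l} k eqA eqB =
      trans (lookup-∩ A B l) (trans (cong₂ _∧_ eqA eqB) (sym (lookup-∩ (swap i j A) (swap i j B) k)))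

  ∣swap∣ : ∀ A → ∣ swap i j A ∣ ≡ ∣ A ∣
  ∣swap∣ A = +-cancelʳ-≡ _ _ _ (+-cancelʳ-≡ _ _ _ (trans
    (card-agreeOff (swap i j A) A i≢j (swap-agreeOff A) (lookup-swap-i A) (lookup-swap-j A) refl refl)
    (xy∙z≈xz∙y ∣ A ∣ ⟦ lookup A j ⟧ ⟦ lookup A i ⟧)))

  ∣swap∩swap∣ : ∀ A B → ∣ swap i j A ∩ swap i j B ∣ ≡ ∣ A ∩ B ∣
  ∣swap∩swap∣ A B = trans (cong ∣_∣ (sym (swap-∩ A B))) (∣swap∣ (A ∩ B))

  ∣swap∩∣ : ∀ A B → ∣ swap i j A ∩ B ∣ ≡ ∣ A ∩ swap i j B ∣
  ∣swap∩∣ A B = begin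
    ∣ swap i j A ∩ B ∣                         ≡⟨ cong (λ C → ∣ swap i j A ∩ C ∣) (swap-involutive B) ⟨
    ∣ swap i j A ∩ swap i j (swap i j B) ∣     ≡⟨ ∣swap∩swap∣ A (swap i j B) ⟩
    ∣ A ∩ swap i j B ∣                         ∎
    where open ≡-Reasoning

  ∣swap∩∣-same : ∀ A B → lookup B i ≡ lookup B j → ∣ swap i j A ∩ B ∣ ≡ ∣ A ∩ B ∣
  ∣swap∩∣-same A B Bᵢ≡Bⱼ =
    trans (cong (λ C → ∣ swap i j A ∩ C ∣) (sym (swap-id B Bᵢ≡Bⱼ))) (∣swap∩swap∣ A B)

  lookup-swap∩-i : ∀ A B → lookup (swap i j A ∩ B) i ≡ lookup A j ∧ lookup B i
  lookup-swap∩-i A B = trans (lookup-∩ (swap i j A) B i) (cong (_∧ lookup B i) (lookup-swap-i A))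

  lookup-swap∩-j : ∀ A B → lookup (swap i j A ∩ B) j ≡ lookup A i ∧ lookup B j
  lookup-swap∩-j A B = trans (lookup-∩ (swap i j A) B j) (cong (_∧ lookup B j) (lookup-swap-j A))

  swap∩-agreeOff : ∀ A B → AgreeOff i j (swap i j A ∩ B) (A ∩ B)
  swap∩-agreeOff A B k k≢i k≢j = trans (lookup-∩ (swap i j A) B k)
    (trans (cong (_∧ lookup B k) (swap-agreeOff A k k≢i k≢j)) (sym (lookup-∩ A B k)))

  ∣∩∣<∣swap∩∣ : ∀ A B → lookup A i ≡ false → lookup A j ≡ true → lookup B i ≡ true → lookup B j ≡ false →
    ∣ A ∩ B ∣ < ∣ swap i j A ∩ B ∣
  ∣∩∣<∣swap∩∣ A B Aᵢ Aⱼ Bᵢ Bⱼ = ≤-reflexive (begin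
      suc ∣ A ∩ B ∣              ≡⟨ +-comm 1 ∣ A ∩ B ∣ ⟩
      ∣ A ∩ B ∣ + 1              ≡⟨ +-identityʳ (∣ A ∩ B ∣ + 1) ⟨
      ∣ A ∩ B ∣ + 1 + 0          ≡⟨ card-agreeOff (swap i j A ∩ B) (A ∩ B) i≢j (swap∩-agreeOff A B)
                                      (trans (lookup-swap∩-i A B) (cong₂ _∧_ Aⱼ Bᵢ))
                                      (trans (lookup-swap∩-j A B) (cong₂ _∧_ Aᵢ Bⱼ))
                                      (trans (lookup-∩ A B i) (cong₂ _∧_ Aᵢ Bᵢ))
                                      (trans (lookup-∩ A B j) (cong₂ _∧_ Aⱼ Bⱼ)) ⟨
      ∣ swap i j A ∩ B ∣ + 0 + 0 ≡⟨ trans (+-identityʳ _) (+-identityʳ _) ⟩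
      ∣ swap i j A ∩ B ∣         ∎)
    where open ≡-Reasoning

  ∣swap∩∣<∣∩∣ : ∀ A B → lookup A i ≡ false → lookup A j ≡ true → lookup B i ≡ false → lookup B j ≡ true →
    ∣ swap i j A ∩ B ∣ < ∣ A ∩ B ∣
  ∣swap∩∣<∣∩∣ A B Aᵢ Aⱼ Bᵢ Bⱼ = ≤-reflexive (begin
      suc ∣ swap i j A ∩ B ∣     ≡⟨ +-comm 1 ∣ swap i j A ∩ B ∣ ⟩
      ∣ swap i j A ∩ B ∣ + 1     ≡⟨ cong (_+ 1) (+-identityʳ _) ⟨
      ∣ swap i j A ∩ B ∣ + 0 + 1 ≡⟨ card-agreeOff (swap i j A ∩ B) (A ∩ B) i≢j (swap∩-agreeOff A B)
                                      (trans (lookup-swap∩-i A B) (cong₂ _∧_ Aⱼ Bᵢ))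
                                      (trans (lookup-swap∩-j A B) (cong₂ _∧_ Aᵢ Bⱼ))
                                      (trans (lookup-∩ A B i) (cong₂ _∧_ Aᵢ Bᵢ))
                                      (trans (lookup-∩ A B j) (cong₂ _∧_ Aⱼ Bⱼ)) ⟩
      ∣ A ∩ B ∣ + 0 + 0          ≡⟨ trans (+-identityʳ _) (+-identityʳ _) ⟩
      ∣ A ∩ B ∣                  ∎)
    where open ≡-Reasoning

  weight-swap< : ∀ A → toℕ i < toℕ j → lookup A i ≡ false → lookup A j ≡ true →
    weight toℕ (swap i j A) < weight toℕ A
  weight-swap< A i<j Aᵢ Aⱼ = +-cancelʳ-< (toℕ j) _ _ (begin-strict
      weight toℕ (swap i j A) + toℕ j     ≡⟨ cong (_+ toℕ j) (+-identityʳ _) ⟨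
      weight toℕ (swap i j A) + 0 + toℕ j ≡⟨ weight-agreeOff toℕ (swap i j A) A i≢j (swap-agreeOff A)
                                              (trans (lookup-swap-i A) Aⱼ) (trans (lookup-swap-j A) Aᵢ) Aᵢ Aⱼ ⟩
      weight toℕ A + toℕ i + 0            ≡⟨ +-identityʳ _ ⟩
      weight toℕ A + toℕ i                <⟨ +-monoʳ-< (weight toℕ A) i<j ⟩
      weight toℕ A + toℕ j                ∎)
    where open ≤-Reasoning

∣∷∣ : ∀ {n} b (A : Subset n) → ∣ b ∷ A ∣ ≡ ⟦ b ⟧ + ∣ A ∣
∣∷∣ true  A = refl
∣∷∣ false A = refl

prefixCard : ∀ {n} → ℕ → Subset n → ℕ
prefixCard zero    _       = 0
prefixCard (suc s) []      = 0
prefixCard (suc s) (b ∷ A) = ⟦ b ⟧ + prefixCard s A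

prefixCard-[] : ∀ s → prefixCard s [] ≡ 0
prefixCard-[] zero    = refl
prefixCard-[] (suc s) = refl

prefixCard≤ : ∀ {n} s (A : Subset n) → prefixCard s A ≤ s
prefixCard≤ zero    _           = z≤n
prefixCard≤ (suc s) []          = z≤n
prefixCard≤ (suc s) (true ∷ A)  = s≤s (prefixCard≤ s A)
prefixCard≤ (suc s) (false ∷ A) = m≤n⇒m≤1+n (prefixCard≤ s A)

prefixCard≤∣∣ : ∀ {n} s (A : Subset n) → prefixCard s A ≤ ∣ A ∣
prefixCard≤∣∣ zero    _           = z≤n
prefixCard≤∣∣ (suc s) []          = z≤n
prefixCard≤∣∣ (suc s) (true ∷ A)  = s≤s (prefixCard≤∣∣ s A)
prefixCard≤∣∣ (suc s) (false ∷ A) = prefixCard≤∣∣ s A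

prefixCard-∩ : ∀ {n} s (A B : Subset n) → prefixCard s A + prefixCard s B ≤ prefixCard s (A ∩ B) + s
prefixCard-∩ zero    _           _           = z≤n
prefixCard-∩ (suc s) []          []          = z≤n
prefixCard-∩ (suc s) (true ∷ A)  (true ∷ B)  =
  subst₂ _≤_ (cong suc (sym (+-suc (prefixCard s A) (prefixCard s B))))
             (sym (+-suc (suc (prefixCard s (A ∩ B))) s))
    (s≤s (s≤s (prefixCard-∩ s A B)))
prefixCard-∩ (suc s) (true ∷ A)  (false ∷ B) =
  subst (suc (prefixCard s A + prefixCard s B) ≤_) (sym (+-suc (prefixCard s (A ∩ B)) s))
    (s≤s (prefixCard-∩ s A B))
prefixCard-∩ (suc s) (false ∷ A) (true ∷ B)  =
  subst₂ _≤_ (sym (+-suc (prefixCard s A) (prefixCard s B))) (sym (+-suc (prefixCard s (A ∩ B)) s))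
    (s≤s (prefixCard-∩ s A B))
prefixCard-∩ (suc s) (false ∷ A) (false ∷ B) =
  ≤-trans (prefixCard-∩ s A B) (+-monoʳ-≤ (prefixCard s (A ∩ B)) (n≤1+n s))

_∈?_ : ∀ {n} (A : Subset n) (𝓕 : Family n) → Dec (A ∈ 𝓕)
_∈?_ = DecMembership._∈?_
  where import Data.List.Membership.DecPropositional (Vec.≡-dec Bool._≟_) as DecMembership

CrossInt-sym : ∀ {n t} {𝓕 𝓖 : Family n} → CrossInt t 𝓕 𝓖 → CrossInt t 𝓖 𝓕
CrossInt-sym {t = t} cross {G} {F} G∈ F∈ = subst (t ≤_) (cong ∣_∣ (∩-comm F G)) (cross F∈ G∈)

module Shift {n} (i j : Fin n) (i≢j : i ≢ j) where

  Movable : Family n → Subset n → Set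
  Movable 𝓕 A = lookup A i ≡ false × lookup A j ≡ true × swap i j A ∉ 𝓕

  movable? : ∀ 𝓕 A → Dec (Movable 𝓕 A)
  movable? 𝓕 A with lookup A i Bool.≟ false | lookup A j Bool.≟ true | swap i j A ∈? 𝓕
  ... | yes Aᵢ | yes Aⱼ | no ∉𝓕 = yes (Aᵢ , Aⱼ , ∉𝓕)
  ... | no ¬Aᵢ | _      | _     = no (¬Aᵢ ∘ proj₁)
  ... | yes _  | no ¬Aⱼ | _     = no (¬Aⱼ ∘ proj₁ ∘ proj₂)
  ... | yes _  | yes _  | yes ∈𝓕 = no (λ (_ , _ , ∉𝓕) → ∉𝓕 ∈𝓕)

  shift : Family n → Subset n → Subset n
  shift 𝓕 A with movable? 𝓕 A
  ... | yes _ = swap i j A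
  ... | no _  = A

  shift-cases : ∀ 𝓕 A → (Movable 𝓕 A × shift 𝓕 A ≡ swap i j A) ⊎ (¬ Movable 𝓕 A × shift 𝓕 A ≡ A)
  shift-cases 𝓕 A with movable? 𝓕 A
  ... | yes m = inj₁ (m , refl)
  ... | no ¬m = inj₂ (¬m , refl)

  shiftFamily : Family n → Family n
  shiftFamily 𝓕 = map (shift 𝓕) 𝓕

  shift-injectiveOn : ∀ 𝓕 {A B} → A ∈ 𝓕 → B ∈ 𝓕 → shift 𝓕 A ≡ shift 𝓕 B → A ≡ B
  shift-injectiveOn 𝓕 {A} {B} A∈ B∈ eq with shift-cases 𝓕 A | shift-cases 𝓕 B
  ... | inj₁ (_ , eqA) | inj₁ (_ , eqB) = begin
      A                       ≡⟨ swap-involutive i≢j A ⟨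
      swap i j (swap i j A)   ≡⟨ cong (swap i j) (trans (sym eqA) (trans eq eqB)) ⟩
      swap i j (swap i j B)   ≡⟨ swap-involutive i≢j B ⟩
      B                       ∎
    where open ≡-Reasoning
  ... | inj₁ ((_ , _ , ∉𝓕) , eqA) | inj₂ (_ , eqB) =
    contradiction (subst (_∈ 𝓕) (sym (trans (sym eqA) (trans eq eqB))) B∈) ∉𝓕
  ... | inj₂ (_ , eqA) | inj₁ ((_ , _ , ∉𝓕) , eqB) =
    contradiction (subst (_∈ 𝓕) (trans (sym eqA) (trans eq eqB)) A∈) ∉𝓕
  ... | inj₂ (_ , eqA) | inj₂ (_ , eqB) = trans (sym eqA) (trans eq eqB)

  shiftFamily-unique : ∀ {𝓕} → Unique 𝓕 → Unique (shiftFamily 𝓕)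
  shiftFamily-unique {𝓕} = Unique-map-injectiveOn (shift-injectiveOn 𝓕)

  ∣shift∣ : ∀ 𝓕 A → ∣ shift 𝓕 A ∣ ≡ ∣ A ∣
  ∣shift∣ 𝓕 A with shift-cases 𝓕 A
  ... | inj₁ (_ , eq) = trans (cong ∣_∣ eq) (∣swap∣ i≢j A)
  ... | inj₂ (_ , eq) = cong ∣_∣ eq

  shiftFamily-uniform : ∀ {m : ℤ} {𝓕} → Uniform m 𝓕 → Uniform m (shiftFamily 𝓕)
  shiftFamily-uniform {𝓕 = 𝓕} unif = All.map⁺ (All.map (λ {A} eq → trans (cong ℤ.+_ (∣shift∣ 𝓕 A)) eq) unif)

  unmoved-crossInt : ∀ {t 𝓕 𝓖} → CrossInt t 𝓕 𝓖 → ∀ {A B} → A ∈ 𝓕 → lookup A i ≡ false → lookup A j ≡ true →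
    B ∈ 𝓖 → ¬ Movable 𝓖 B → t ≤ ∣ swap i j A ∩ B ∣
  unmoved-crossInt {t} {𝓖 = 𝓖} cross {A} {B} A∈ Aᵢ Aⱼ B∈ ¬movable =
    by-cases (lookup B i) (lookup B j) refl refl
    where
    by-cases : ∀ bᵢ bⱼ → lookup B i ≡ bᵢ → lookup B j ≡ bⱼ → t ≤ ∣ swap i j A ∩ B ∣
    by-cases true  false Bᵢ Bⱼ = ≤-trans (cross A∈ B∈) (<⇒≤ (∣∩∣<∣swap∩∣ i≢j A B Aᵢ Aⱼ Bᵢ Bⱼ))
    by-cases true  true  Bᵢ Bⱼ = subst (t ≤_) (sym (∣swap∩∣-same i≢j A B (trans Bᵢ (sym Bⱼ)))) (cross A∈ B∈)
    by-cases false false Bᵢ Bⱼ = subst (t ≤_) (sym (∣swap∩∣-same i≢j A B (trans Bᵢ (sym Bⱼ)))) (cross A∈ B∈)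
    by-cases false true  Bᵢ Bⱼ with swap i j B ∈? 𝓖
    ... | yes swapB∈ = subst (t ≤_) (sym (∣swap∩∣ i≢j A B)) (cross A∈ swapB∈)
    ... | no swapB∉  = contradiction (Bᵢ , Bⱼ , swapB∉) ¬movable

  moved-crossInt : ∀ {t 𝓕 𝓖} → CrossInt t 𝓕 𝓖 → ∀ {A B} → A ∈ 𝓕 → Movable 𝓕 A → B ∈ 𝓖 →
    t ≤ ∣ swap i j A ∩ shift 𝓖 B ∣
  moved-crossInt {t} {𝓕} {𝓖} cross {A} {B} A∈ (Aᵢ , Aⱼ , _) B∈ with shift-cases 𝓖 B
  ... | inj₁ (_ , eqB) rewrite eqB = subst (t ≤_) (sym (∣swap∩swap∣ i≢j A B)) (cross A∈ B∈)
  ... | inj₂ (¬movable , eqB) rewrite eqB = unmoved-crossInt cross A∈ Aᵢ Aⱼ B∈ ¬movable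

  shiftFamily-crossInt : ∀ {t 𝓕 𝓖} → CrossInt t 𝓕 𝓖 → CrossInt t (shiftFamily 𝓕) (shiftFamily 𝓖)
  shiftFamily-crossInt {t} {𝓕} {𝓖} cross A′∈ B′∈ with ∈-map⁻ (shift 𝓕) A′∈ | ∈-map⁻ (shift 𝓖) B′∈
  ... | A , A∈ , refl | B , B∈ , refl with shift-cases 𝓕 A | shift-cases 𝓖 B
  ... | inj₁ (movable , eqA) | _ rewrite eqA = moved-crossInt cross A∈ movable B∈
  ... | inj₂ (_ , eqA) | inj₁ (movable , eqB) rewrite eqA | eqB =
    subst (t ≤_) (cong ∣_∣ (∩-comm (swap i j B) A))
      (subst (λ C → t ≤ ∣ swap i j B ∩ C ∣) eqA (moved-crossInt (CrossInt-sym {𝓕 = 𝓕} cross) B∈ movable A∈))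
  ... | inj₂ (_ , eqA) | inj₂ (_ , eqB) rewrite eqA | eqB = cross A∈ B∈

Shifted : ∀ {n} → Family n → Set
Shifted {n} 𝓕 = ∀ {A} → A ∈ 𝓕 → (i j : Fin n) → toℕ i < toℕ j →
  lookup A i ≡ false → lookup A j ≡ true → swap i j A ∈ 𝓕

ShiftableAt : ∀ {n} → Family n → Subset n → Fin n → Fin n → Set
ShiftableAt 𝓕 A i j = toℕ i < toℕ j × lookup A i ≡ false × lookup A j ≡ true × swap i j A ∉ 𝓕

shifted? : ∀ {n} (𝓕 : Family n) →
  Shifted 𝓕 ⊎ ∃ (λ A → A ∈ 𝓕 × ∃ (λ i → ∃ (λ j → ShiftableAt 𝓕 A i j)))
shifted? {n} 𝓕 with List-∀⊎∃ 𝓕 (λ A → Fin-∀⊎∃ (λ i → Fin-∀⊎∃ (decideAt A i)))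
  where
  decideAt : ∀ A i j →
    (toℕ i < toℕ j → lookup A i ≡ false → lookup A j ≡ true → swap i j A ∈ 𝓕) ⊎ ShiftableAt 𝓕 A i j
  decideAt A i j with toℕ i <? toℕ j | lookup A i Bool.≟ false | lookup A j Bool.≟ true | swap i j A ∈? 𝓕
  ... | yes i<j | yes Aᵢ | yes Aⱼ | no ∉𝓕 = inj₂ (i<j , Aᵢ , Aⱼ , ∉𝓕)
  ... | yes _   | yes _  | yes _  | yes ∈𝓕 = inj₁ (λ _ _ _ → ∈𝓕)
  ... | no i≮j  | _      | _      | _      = inj₁ (λ i<j → contradiction i<j i≮j)
  ... | yes _   | no ¬Aᵢ | _      | _      = inj₁ (λ _ Aᵢ → contradiction Aᵢ ¬Aᵢ)
  ... | yes _   | yes _  | no ¬Aⱼ | _      = inj₁ (λ _ _ Aⱼ → contradiction Aⱼ ¬Aⱼ)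
... | inj₁ shifted   = inj₁ (λ A∈ i j → shifted A∈ i j)
... | inj₂ shiftable = inj₂ shiftable

shift-admissible : ∀ {n a b t} {i j : Fin n} (i≢j : i ≢ j) {𝓕 𝓖} → Admissible n a b t 𝓕 𝓖 →
  let open Shift i j i≢j in Admissible n a b t (shiftFamily 𝓕) (shiftFamily 𝓖)
shift-admissible {i = i} {j} i≢j (u𝓕 , u𝓖 , unif𝓕 , unif𝓖 , cross) =
  shiftFamily-unique u𝓕 , shiftFamily-unique u𝓖 , shiftFamily-uniform unif𝓕 , shiftFamily-uniform unif𝓖 ,
  shiftFamily-crossInt cross
  where open Shift i j i≢j

weightSum : ∀ {n} → Family n → ℕ
weightSum 𝓕 = sum (map (weight toℕ) 𝓕)

weightSum-shiftFamily< : ∀ {n} {i j : Fin n} (i≢j : i ≢ j) {𝓕 A} → A ∈ 𝓕 → ShiftableAt 𝓕 A i j →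
  let open Shift i j i≢j in weightSum (shiftFamily 𝓕) < weightSum 𝓕
weightSum-shiftFamily< {i = i} {j} i≢j {𝓕} {A} A∈ (i<j , Aᵢ , Aⱼ , ∉𝓕) =
  sum-map-< (weight toℕ) (shift 𝓕) 𝓕 weight-shift≤ A∈ weight-shiftA<
  where
  open Shift i j i≢j
  weight-shift≤ : ∀ B → weight toℕ (shift 𝓕 B) ≤ weight toℕ B
  weight-shift≤ B with shift-cases 𝓕 B
  ... | inj₁ ((Bᵢ , Bⱼ , _) , eq) rewrite eq = <⇒≤ (weight-swap< i≢j B i<j Bᵢ Bⱼ)
  ... | inj₂ (_ , eq) rewrite eq = ≤-refl
  weight-shiftA< : weight toℕ (shift 𝓕 A) < weight toℕ A
  weight-shiftA< with shift-cases 𝓕 A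
  ... | inj₁ (_ , eq) rewrite eq = weight-swap< i≢j A i<j Aᵢ Aⱼ
  ... | inj₂ (¬movable , _) = contradiction (Aᵢ , Aⱼ , ∉𝓕) ¬movable

shift-step : ∀ {n a b t} {𝓕 𝓖 : Family n} {A i j} → A ∈ 𝓕 → ShiftableAt 𝓕 A i j → Admissible n a b t 𝓕 𝓖 →
  Σ (Family n) λ 𝓕′ → Σ (Family n) λ 𝓖′ → Admissible n a b t 𝓕′ 𝓖′ ×
    weightSum 𝓕′ < weightSum 𝓕 × length 𝓕′ ≡ length 𝓕 × length 𝓖′ ≡ length 𝓖
shift-step {𝓕 = 𝓕} {𝓖} {i = i} {j} A∈ shiftable@(i<j , _) adm =
  shiftFamily 𝓕 , shiftFamily 𝓖 , shift-admissible i≢j adm , weightSum-shiftFamily< i≢j A∈ shiftable ,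
  length-map _ 𝓕 , length-map _ 𝓖
  where
  i≢j : i ≢ j
  i≢j i≡j = <-irrefl (cong toℕ i≡j) i<j
  open Shift i j i≢j

compress : ∀ {n a b t} k (𝓕 𝓖 : Family n) → weightSum 𝓕 < k → Admissible n a b t 𝓕 𝓖 →
  Σ (Family n) λ 𝓕′ → Σ (Family n) λ 𝓖′ →
    Admissible n a b t 𝓕′ 𝓖′ × Shifted 𝓕′ × length 𝓕′ ≡ length 𝓕 × length 𝓖′ ≡ length 𝓖
compress (suc k) 𝓕 𝓖 w< adm with shifted? 𝓕
... | inj₁ shifted = 𝓕 , 𝓖 , adm , shifted , refl , refl
... | inj₂ (A , A∈ , _ , _ , shiftable) with shift-step A∈ shiftable adm
...   | 𝓕₁ , 𝓖₁ , adm₁ , w₁< , ∣𝓕₁∣ , ∣𝓖₁∣ with compress k 𝓕₁ 𝓖₁ (≤-trans w₁< (≤-pred w<)) adm₁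
...     | 𝓕′ , 𝓖′ , adm′ , shifted′ , ∣𝓕′∣ , ∣𝓖′∣ =
  𝓕′ , 𝓖′ , adm′ , shifted′ , trans ∣𝓕′∣ ∣𝓕₁∣ , trans ∣𝓖′∣ ∣𝓖₁∣

slackStep : ℕ → Bool → Bool → ℕ
slackStep c true  true  = c ∸ 1
slackStep c true  false = c
slackStep c false true  = c
slackStep c false false = suc c

-- Along the prefixes [s] of [n] the counter is c + s − |A ∩ [s]| − |B ∩ [s]|;
-- Slack c A B says that it never drops below 1.
Slack : ∀ {n} → ℕ → Subset n → Subset n → Set
Slack c []      []      = 1 ≤ c
Slack c (a ∷ A) (b ∷ B) = 1 ≤ c × Slack (slackStep c a b) A B

Slack⇒1≤ : ∀ {n} c (A B : Subset n) → Slack c A B → 1 ≤ c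
Slack⇒1≤ c []      []      1≤c       = 1≤c
Slack⇒1≤ c (_ ∷ _) (_ ∷ _) (1≤c , _) = 1≤c

Slack⊎profile : ∀ {n} c (A B : Subset n) →
  Slack c A B ⊎ ∃ λ s → s ≤ n × s + c ≤ prefixCard s A + prefixCard s B
Slack⊎profile zero    []      []      = inj₂ (0 , z≤n , z≤n)
Slack⊎profile (suc c) []      []      = inj₁ (s≤s z≤n)
Slack⊎profile zero    (_ ∷ _) (_ ∷ _) = inj₂ (0 , z≤n , z≤n)
Slack⊎profile (suc c) (a ∷ A) (b ∷ B) with Slack⊎profile (slackStep (suc c) a b) A B
... | inj₁ slack = inj₁ (s≤s z≤n , slack)
... | inj₂ (s , s≤n , ≤pre) = inj₂ (suc s , s≤s s≤n , step a b ≤pre)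
  where
  step : ∀ a b → s + slackStep (suc c) a b ≤ prefixCard s A + prefixCard s B →
    suc s + suc c ≤ prefixCard (suc s) (a ∷ A) + prefixCard (suc s) (b ∷ B)
  step true  true  ≤pre = subst₂ _≤_ (cong suc (sym (+-suc s c)))
                                     (cong suc (sym (+-suc (prefixCard s A) (prefixCard s B)))) (s≤s (s≤s ≤pre))
  step true  false ≤pre = s≤s ≤pre
  step false true  ≤pre = subst (suc s + suc c ≤_) (sym (+-suc (prefixCard s A) (prefixCard s B))) (s≤s ≤pre)
  step false false ≤pre = subst (_≤ prefixCard s A + prefixCard s B) (+-suc s (suc c)) ≤pre

Slack-removeCommon : ∀ {n} c (A B : Subset n) → 1 ≤ c → Slack (suc c) A B → 1 ≤ ∣ A ∩ B ∣ →
  ∃ λ x → lookup A x ≡ true × lookup B x ≡ true × Slack c (A [ x ]≔ false) B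
Slack-removeCommon c []          []          _   _         ()
Slack-removeCommon c (true ∷ A)  (true ∷ B)  1≤c (_ , slack) _ = zero , refl , refl , 1≤c , slack
Slack-removeCommon c (true ∷ A)  (false ∷ B) 1≤c (_ , slack) 1≤∩ with Slack-removeCommon c A B 1≤c slack 1≤∩
... | x , Aₓ , Bₓ , slack′ = suc x , Aₓ , Bₓ , 1≤c , slack′
Slack-removeCommon c (false ∷ A) (true ∷ B)  1≤c (_ , slack) 1≤∩ with Slack-removeCommon c A B 1≤c slack 1≤∩
... | x , Aₓ , Bₓ , slack′ = suc x , Aₓ , Bₓ , 1≤c , slack′
Slack-removeCommon c (false ∷ A) (false ∷ B) 1≤c (_ , slack) 1≤∩
  with Slack-removeCommon (suc c) A B (s≤s z≤n) slack 1≤∩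
... | x , Aₓ , Bₓ , slack′ = suc x , Aₓ , Bₓ , 1≤c , slack′

-- The first position y outside A ∪ B is followed by a common element x; moving x to y
-- lowers the counter by one on the prefixes between them, where it was at least 2.
Slack-swap : ∀ {n} c (A B : Subset n) → Slack c A B → c ≤ ∣ A ∩ B ∣ →
  ∃ λ y → ∃ λ x → toℕ y < toℕ x × lookup A y ≡ false × lookup B y ≡ false ×
    lookup A x ≡ true × lookup B x ≡ true × Slack c (swap y x A) B
Slack-swap c [] [] slack c≤∩ = ⊥-elim (1+n≰n (≤-trans (Slack⇒1≤ c [] [] slack) c≤∩))
Slack-swap (suc c) (true ∷ A) (true ∷ B) (1≤c , slack) (s≤s c≤∩) with Slack-swap c A B slack c≤∩
... | y , x , y<x , Aᵧ , Bᵧ , Aₓ , Bₓ , slack′ = suc y , suc x , s≤s y<x , Aᵧ , Bᵧ , Aₓ , Bₓ , 1≤c , slack′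
Slack-swap c (true ∷ A) (false ∷ B) (1≤c , slack) c≤∩ with Slack-swap c A B slack c≤∩
... | y , x , y<x , Aᵧ , Bᵧ , Aₓ , Bₓ , slack′ = suc y , suc x , s≤s y<x , Aᵧ , Bᵧ , Aₓ , Bₓ , 1≤c , slack′
Slack-swap c (false ∷ A) (true ∷ B) (1≤c , slack) c≤∩ with Slack-swap c A B slack c≤∩
... | y , x , y<x , Aᵧ , Bᵧ , Aₓ , Bₓ , slack′ = suc y , suc x , s≤s y<x , Aᵧ , Bᵧ , Aₓ , Bₓ , 1≤c , slack′
Slack-swap c (false ∷ A) (false ∷ B) (1≤c , slack) c≤∩ with Slack-removeCommon c A B 1≤c slack (≤-trans 1≤c c≤∩)
... | x , Aₓ , Bₓ , slack′ = zero , suc x , s≤s z≤n , refl , refl , Aₓ , Bₓ ,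
  subst (λ b → Slack c (b ∷ (A [ x ]≔ false)) (false ∷ B)) (sym Aₓ) (1≤c , slack′)

-- Induction on |A ∩ B|: each swap stays in 𝓕 and lowers |A ∩ B| by one, keeping the slack.
shifted-¬Slack : ∀ {n t} {𝓕 𝓖 : Family n} → Shifted 𝓕 → CrossInt t 𝓕 𝓖 →
  ∀ k {A B} → ∣ A ∩ B ∣ ≤ k → A ∈ 𝓕 → B ∈ 𝓖 → ¬ Slack t A B
shifted-¬Slack {t = t} shifted cross zero {A} {B} ∩≤0 A∈ B∈ slack =
  1+n≰n (≤-trans (≤-trans (Slack⇒1≤ t A B slack) (cross A∈ B∈)) ∩≤0)
shifted-¬Slack {t = t} shifted cross (suc k) {A} {B} ∩≤k A∈ B∈ slack
  with Slack-swap t A B slack (cross A∈ B∈)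
... | y , x , y<x , Aᵧ , Bᵧ , Aₓ , Bₓ , slack′ =
  shifted-¬Slack shifted cross k (≤-pred (≤-trans (∣swap∩∣<∣∩∣ y≢x A B Aᵧ Aₓ Bᵧ Bₓ) ∩≤k))
    (shifted A∈ y x y<x Aᵧ Aₓ) B∈ slack′
  where
  y≢x : y ≢ x
  y≢x y≡x = <-irrefl (cong toℕ y≡x) y<x

shifted-profile : ∀ {n t} {𝓕 𝓖 : Family n} → Shifted 𝓕 → CrossInt t 𝓕 𝓖 → ∀ {A B} → A ∈ 𝓕 → B ∈ 𝓖 →
  ∃ λ s → s ≤ n × s + t ≤ prefixCard s A + prefixCard s B
shifted-profile {t = t} shifted cross {A} {B} A∈ B∈ with Slack⊎profile t A B
... | inj₁ slack   = ⊥-elim (shifted-¬Slack shifted cross _ ≤-refl A∈ B∈ slack)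
... | inj₂ profile = profile

profile-positive : ∀ {s t u v} → 1 ≤ t → s + t ≤ u + v → v ≤ s → 1 ≤ u
profile-positive {s} {suc t} {zero}  _ s+t≤v v≤s = contradiction (≤-trans s+t≤v v≤s) (m+1+n≰m s)
profile-positive {u = suc u} _ _ _ = s≤s z≤n

consLayers : ∀ {n} → (ℕ → List (Subset n)) → ℕ → List (Subset (suc n))
consLayers L zero    = map (false ∷_) (L zero)
consLayers L (suc k) = map (true ∷_) (L k) ++ map (false ∷_) (L (suc k))

length-consLayers-suc : ∀ {n} (L : ℕ → List (Subset n)) k →
  length (consLayers L (suc k)) ≡ length (L k) + length (L (suc k))
length-consLayers-suc L k = trans (length-++ (map (true ∷_) (L k)))
  (cong₂ _+_ (length-map (true ∷_) (L k)) (length-map (false ∷_) (L (suc k))))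

∈-consLayers⁺ : ∀ {n} {L : ℕ → List (Subset n)} {A k} b → A ∈ L k → (b ∷ A) ∈ consLayers L (⟦ b ⟧ + k)
∈-consLayers⁺ {L = L} {k = zero}  false A∈ = ∈-map⁺ (false ∷_) A∈
∈-consLayers⁺ {L = L} {k = suc k} false A∈ = ∈-++⁺ʳ (map (true ∷_) (L k)) (∈-map⁺ (false ∷_) A∈)
∈-consLayers⁺ {L = L} {k = k}     true  A∈ = ∈-++⁺ˡ (∈-map⁺ (true ∷_) A∈)

∈-consLayers⁻ : ∀ {n} {L : ℕ → List (Subset n)} {b A} k → (b ∷ A) ∈ consLayers L k →
  ∃ λ k′ → k ≡ ⟦ b ⟧ + k′ × A ∈ L k′
∈-consLayers⁻ zero A∈ with ∈-map⁻ (false ∷_) A∈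
... | _ , A∈′ , refl = zero , refl , A∈′
∈-consLayers⁻ {L = L} (suc k) A∈ with ∈-++⁻ (map (true ∷_) (L k)) A∈
... | inj₁ A∈ᵗ with ∈-map⁻ (true ∷_) A∈ᵗ
...   | _ , A∈′ , refl = k , refl , A∈′
∈-consLayers⁻ {L = L} (suc k) A∈ | inj₂ A∈ᶠ with ∈-map⁻ (false ∷_) A∈ᶠ
...   | _ , A∈′ , refl = suc k , refl , A∈′

consLayers-unique : ∀ {n} {L : ℕ → List (Subset n)} → (∀ k → Unique (L k)) → ∀ k → Unique (consLayers L k)
consLayers-unique uL zero    = Unique.map⁺ Vec.∷-injectiveʳ (uL zero)
consLayers-unique {L = L} uL (suc k) =
  Unique.++⁺ (Unique.map⁺ Vec.∷-injectiveʳ (uL k)) (Unique.map⁺ Vec.∷-injectiveʳ (uL (suc k))) disjoint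
  where
  disjoint : ∀ {A} → A ∈ map (true ∷_) (L k) × A ∈ map (false ∷_) (L (suc k)) → ⊥
  disjoint (A∈ᵗ , A∈ᶠ) with ∈-map⁻ (true ∷_) A∈ᵗ | ∈-map⁻ (false ∷_) A∈ᶠ
  ... | _ , _ , refl | _ , _ , ()

-- The subsets A of [n] with |A ∩ [s]| = u and |A ∖ [s]| = w.
Layer : (n s u w : ℕ) → List (Subset n)
Layer zero    _       zero    zero    = [ [] ]
Layer zero    _       zero    (suc w) = []
Layer zero    _       (suc u) _       = []
Layer (suc n) (suc s) u       w       = consLayers (λ u′ → Layer n s u′ w) u
Layer (suc n) zero    zero    w       = consLayers (Layer n zero zero) w
Layer (suc n) zero    (suc u) _       = []

∈-Layer⁻ : ∀ n s u w {A} → A ∈ Layer n s u w → prefixCard s A ≡ u × ∣ A ∣ ≡ u + w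
∈-Layer⁻ zero s zero zero (here refl) = prefixCard-[] s , refl
∈-Layer⁻ (suc n) (suc s) u w {b ∷ A} A∈ with ∈-consLayers⁻ u A∈
... | u′ , refl , A∈′ with ∈-Layer⁻ n s u′ w A∈′
...   | refl , ∣A∣≡ = refl , trans (∣∷∣ b A) (trans (cong (⟦ b ⟧ +_) ∣A∣≡) (sym (+-assoc ⟦ b ⟧ _ w)))
∈-Layer⁻ (suc n) zero zero w {b ∷ A} A∈ with ∈-consLayers⁻ w A∈
... | w′ , refl , A∈′ = refl , trans (∣∷∣ b A) (cong (⟦ b ⟧ +_) (proj₂ (∈-Layer⁻ n zero zero w′ A∈′)))

∈-Layer⁺ : ∀ n s u w (A : Subset n) → prefixCard s A ≡ u → ∣ A ∣ ≡ u + w → A ∈ Layer n s u w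
∈-Layer⁺ zero s u w [] pre≡ ∣A∣≡ with trans (sym (prefixCard-[] s)) pre≡ | ∣A∣≡
... | refl | refl = here refl
∈-Layer⁺ (suc n) (suc s) _ w (b ∷ A) refl ∣A∣≡ =
  ∈-consLayers⁺ b (∈-Layer⁺ n s (prefixCard s A) w A refl (+-cancelˡ-≡ ⟦ b ⟧ _ _ (begin
    ⟦ b ⟧ + ∣ A ∣                            ≡⟨ ∣∷∣ b A ⟨
    ∣ b ∷ A ∣                                ≡⟨ ∣A∣≡ ⟩
    ⟦ b ⟧ + prefixCard s A + w               ≡⟨ +-assoc ⟦ b ⟧ _ w ⟩
    ⟦ b ⟧ + (prefixCard s A + w)             ∎)))
  where open ≡-Reasoning
∈-Layer⁺ (suc n) zero zero w (b ∷ A) _ ∣A∣≡ =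
  subst (λ k → (b ∷ A) ∈ consLayers (Layer n zero zero) k) (trans (sym (∣∷∣ b A)) ∣A∣≡)
    (∈-consLayers⁺ b (∈-Layer⁺ n zero zero ∣ A ∣ A refl refl))

Layer-unique : ∀ n s u w → Unique (Layer n s u w)
Layer-unique zero    _       zero    zero    = [] ∷ []
Layer-unique zero    _       zero    (suc w) = []
Layer-unique zero    _       (suc u) _       = []
Layer-unique (suc n) (suc s) u       w       = consLayers-unique (λ u′ → Layer-unique n s u′ w) u
Layer-unique (suc n) zero    zero    w       = consLayers-unique (Layer-unique n zero zero) w
Layer-unique (suc n) zero    (suc u) _       = []

length-Layer : ∀ n s u w → s ≤ n → length (Layer n s u w) ≡ (s C u) * ((n ∸ s) C w)
length-Layer zero    zero    zero    zero    _ = refl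
length-Layer zero    zero    zero    (suc w) _ = sym (k>n⇒nCk≡0 {0} {suc w} (s≤s z≤n))
length-Layer zero    zero    (suc u) w       _ = sym (cong (_* (0 C w)) (k>n⇒nCk≡0 {0} {suc u} (s≤s z≤n)))
length-Layer (suc n) (suc s) zero    w (s≤s s≤n) =
  trans (length-map (false ∷_) (Layer n s zero w)) (length-Layer n s zero w s≤n)
length-Layer (suc n) (suc s) (suc u) w (s≤s s≤n) = begin
    length (Layer (suc n) (suc s) (suc u) w)       ≡⟨ length-consLayers-suc (λ u′ → Layer n s u′ w) u ⟩
    length (Layer n s u w) + length (Layer n s (suc u) w)
      ≡⟨ cong₂ _+_ (length-Layer n s u w s≤n) (length-Layer n s (suc u) w s≤n) ⟩
    (s C u) * X + (s C suc u) * X                   ≡⟨ *-distribʳ-+ X (s C u) (s C suc u) ⟨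
    (s C u + s C suc u) * X                         ≡⟨ cong (_* X) (nCk+nC[k+1]≡[n+1]C[k+1] s u) ⟩
    (suc s C suc u) * X                             ∎
  where
  open ≡-Reasoning
  X = (n ∸ s) C w
length-Layer (suc n) zero zero zero _ =
  trans (length-map (false ∷_) (Layer n zero zero zero)) (length-Layer n zero zero zero z≤n)
length-Layer (suc n) zero zero (suc w) _ = begin
    length (Layer (suc n) zero zero (suc w))       ≡⟨ length-consLayers-suc (Layer n zero zero) w ⟩
    length (Layer n zero zero w) + length (Layer n zero zero (suc w))
      ≡⟨ cong₂ _+_ (length-Layer n zero zero w z≤n) (length-Layer n zero zero (suc w) z≤n) ⟩
    1 * (n C w) + 1 * (n C suc w)                  ≡⟨ cong₂ _+_ (*-identityˡ (n C w)) (*-identityˡ (n C suc w)) ⟩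
    n C w + n C suc w                              ≡⟨ nCk+nC[k+1]≡[n+1]C[k+1] n w ⟩
    suc n C suc w                                  ≡⟨ *-identityˡ (suc n C suc w) ⟨
    1 * (suc n C suc w)                            ∎
  where open ≡-Reasoning
length-Layer (suc n) zero (suc u) w _ = sym (cong (_* (suc n C w)) (k>n⇒nCk≡0 {0} {suc u} (s≤s z≤n)))

Layerℤ : (n s u : ℕ) → ℤ → List (Subset n)
Layerℤ n s u (ℤ.+ w)    = Layer n s u w
Layerℤ n s u ℤ.-[1+ _ ] = []

Slice : (n s u : ℕ) → ℤ → List (Subset n)
Slice n s u m = Layerℤ n s u (m ℤ.- ℤ.+ u)

length-Slice : ∀ n s u m → s ≤ n → length (Slice n s u m) ≡ (s C u) * binomℤ (n ∸ s) (m ℤ.- ℤ.+ u)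
length-Slice n s u m s≤n with m ℤ.- ℤ.+ u
... | ℤ.+ w    = length-Layer n s u w s≤n
... | ℤ.-[1+ _ ] = sym (*-zeroʳ (s C u))

Slice-unique : ∀ n s u m → Unique (Slice n s u m)
Slice-unique n s u m with m ℤ.- ℤ.+ u
... | ℤ.+ w    = Layer-unique n s u w
... | ℤ.-[1+ _ ] = []

∈-Slice⁻ : ∀ n s u m {A} → A ∈ Slice n s u m → prefixCard s A ≡ u × ℤ.+ ∣ A ∣ ≡ m
∈-Slice⁻ n s u m A∈ with m ℤ.- ℤ.+ u in m-u≡
... | ℤ.+ w with ∈-Layer⁻ n s u w A∈
...   | pre≡ , ∣A∣≡ = pre≡ , trans (cong ℤ.+_ ∣A∣≡) (sym (m-n≡+w⇒m≡+[n+w] m u w m-u≡))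

∈-Slice⁺ : ∀ n s (A : Subset n) → A ∈ Slice n s (prefixCard s A) (ℤ.+ ∣ A ∣)
∈-Slice⁺ n s A = subst (λ z → A ∈ Layerℤ n s (prefixCard s A) z) (sym ∣A∣-pre)
  (∈-Layer⁺ n s _ _ A refl (sym (m+[n∸m]≡n (prefixCard≤∣∣ s A))))
  where
  ∣A∣-pre : ℤ.+ ∣ A ∣ ℤ.- ℤ.+ prefixCard s A ≡ ℤ.+ (∣ A ∣ ∸ prefixCard s A)
  ∣A∣-pre = trans (ℤ.m-n≡m⊖n ∣ A ∣ (prefixCard s A)) (ℤ.⊖-≥ (prefixCard≤∣∣ s A))

Slice-crossInt : ∀ n s u v (a b : ℤ) t → s + t ≤ u + v → CrossInt t (Slice n s u a) (Slice n s v b)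
Slice-crossInt n s u v a b t s+t≤u+v {A} {B} A∈ B∈
  with ∈-Slice⁻ n s u a A∈ | ∈-Slice⁻ n s v b B∈
... | refl , _ | refl , _ = +-cancelˡ-≤ s t ∣ A ∩ B ∣ (begin
  s + t                                        ≤⟨ s+t≤u+v ⟩
  prefixCard s A + prefixCard s B              ≤⟨ prefixCard-∩ s A B ⟩
  prefixCard s (A ∩ B) + s                     ≤⟨ +-monoˡ-≤ s (prefixCard≤∣∣ s (A ∩ B)) ⟩
  ∣ A ∩ B ∣ + s                                ≡⟨ +-comm ∣ A ∩ B ∣ s ⟩
  s + ∣ A ∩ B ∣                                ∎)
  where open ≤-Reasoning

module Counting (n : ℕ) (a b : ℤ) (t : ℕ) where

  summand : ℕ → ℕ → ℕ → ℕ
  summand s u v = if (s + t) ≤ᵇ (u + v) then term n a b u v s else 0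

  block : ℕ → ℕ → ℕ → List (Subset n × Subset n)
  block s u v = if (s + t) ≤ᵇ (u + v) then cartesianProduct (Slice n s u a) (Slice n s v b) else []

  -- M n a b t is definitionally maxList summands.
  summands : List ℕ
  summands = concatMap (λ s → concatMap (λ u → map (summand s u) (range1 n)) (range1 n)) (range1 n)

  blocks : List (Subset n × Subset n)
  blocks = concatMap (λ s → concatMap (λ u → concatMap (block s u) (range1 n)) (range1 n)) (range1 n)

  length-Slice*Slice : ∀ s u v → s ≤ n → length (Slice n s u a) * length (Slice n s v b) ≡ term n a b u v s
  length-Slice*Slice s u v s≤n = trans (cong₂ _*_ (length-Slice n s u a s≤n) (length-Slice n s v b s≤n))
    (sym (*-assoc ((s C u) * binomℤ (n ∸ s) (a ℤ.- ℤ.+ u)) (s C v) (binomℤ (n ∸ s) (b ℤ.- ℤ.+ v))))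

  length-block : ∀ s u v → s ≤ n → length (block s u v) ≡ summand s u v
  length-block s u v s≤n with (s + t) ≤ᵇ (u + v)
  ... | true  = trans (length-cartesianProduct (Slice n s u a) (Slice n s v b)) (length-Slice*Slice s u v s≤n)
  ... | false = refl

  summand≤M : ∀ {s u v} → s ∈ range1 n → u ∈ range1 n → v ∈ range1 n → summand s u v ≤ M n a b t
  summand≤M {s} {u} s∈ u∈ v∈ = ≤-maxList
    (∈-concatMap⁺′ (λ s → concatMap (λ u → map (summand s u) (range1 n)) (range1 n)) s∈
      (∈-concatMap⁺′ (λ u → map (summand s u) (range1 n)) u∈ (∈-map⁺ (summand s u) v∈)))

  length-blocks : length blocks ≤ n ^ 3 * M n a b t
  length-blocks = begin
    length blocks                            ≤⟨ length-concatMap≤ _ (range1 n) (λ s∈ →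
                                                  length-concatMap≤ _ (range1 n) (λ u∈ →
                                                    length-concatMap≤ _ (range1 n) (λ v∈ → block≤M s∈ u∈ v∈))) ⟩
    ∣R∣ * (∣R∣ * (∣R∣ * M n a b t))          ≡⟨ cong (λ k → k * (k * (k * M n a b t))) (length-range1 n) ⟩
    n * (n * (n * M n a b t))                ≡⟨ cube n (M n a b t) ⟩
    n ^ 3 * M n a b t                        ∎
    where
    open ≤-Reasoning
    ∣R∣ = length (range1 n)
    block≤M : ∀ {s u v} → s ∈ range1 n → u ∈ range1 n → v ∈ range1 n → length (block s u v) ≤ M n a b t
    block≤M {s} {u} {v} s∈ u∈ v∈ =
      subst (_≤ M n a b t) (sym (length-block s u v (∈-range1⁻ s∈))) (summand≤M s∈ u∈ v∈)
    cube : ∀ k m → k * (k * (k * m)) ≡ k * (k * (k * 1)) * m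
    cube = solve-∀

  ∈-block : ∀ {s u v A B} → s + t ≤ u + v → A ∈ Slice n s u a → B ∈ Slice n s v b → (A , B) ∈ block s u v
  ∈-block {s} {u} {v} s+t≤ A∈ B∈ with (s + t) ≤ᵇ (u + v) | ≤⇒≤ᵇ s+t≤
  ... | true | _ = ∈-cartesianProduct⁺ A∈ B∈

  ∈-blocks : ∀ {s A B} → 1 ≤ t → s ≤ n → s + t ≤ prefixCard s A + prefixCard s B →
    ℤ.+ ∣ A ∣ ≡ a → ℤ.+ ∣ B ∣ ≡ b → (A , B) ∈ blocks
  ∈-blocks {s} {A} {B} 1≤t s≤n s+t≤ refl refl =
    ∈-concatMap⁺′ (λ s → concatMap (λ u → concatMap (block s u) (range1 n)) (range1 n)) (∈-range1 1≤s s≤n)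
      (∈-concatMap⁺′ (λ u → concatMap (block s u) (range1 n)) (∈-range1 1≤u (≤-trans (prefixCard≤ s A) s≤n))
        (∈-concatMap⁺′ (block s (prefixCard s A)) (∈-range1 1≤v (≤-trans (prefixCard≤ s B) s≤n))
          (∈-block {u = prefixCard s A} {v = prefixCard s B} s+t≤ (∈-Slice⁺ n s A) (∈-Slice⁺ n s B))))
    where
    1≤u = profile-positive 1≤t s+t≤ (prefixCard≤ s B)
    1≤v = profile-positive 1≤t (subst (s + t ≤_) (+-comm (prefixCard s A) _) s+t≤) (prefixCard≤ s A)
    1≤s = ≤-trans 1≤u (prefixCard≤ s A)

  shifted-upper : ∀ {𝓕 𝓖} → 1 ≤ t → Admissible n a b t 𝓕 𝓖 → Shifted 𝓕 →
    length 𝓕 * length 𝓖 ≤ n ^ 3 * M n a b t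
  shifted-upper {𝓕} {𝓖} 1≤t (u𝓕 , u𝓖 , unif𝓕 , unif𝓖 , cross) shifted = begin
    length 𝓕 * length 𝓖             ≡⟨ length-cartesianProduct 𝓕 𝓖 ⟨
    length (cartesianProduct 𝓕 𝓖)  ≤⟨ Unique⇒length≤ (Unique.cartesianProduct⁺ u𝓕 u𝓖) 𝓕×𝓖⊆blocks ⟩
    length blocks                   ≤⟨ length-blocks ⟩
    n ^ 3 * M n a b t               ∎
    where
    open ≤-Reasoning
    𝓕×𝓖⊆blocks : cartesianProduct 𝓕 𝓖 ⊆ blocks
    𝓕×𝓖⊆blocks {A , B} AB∈ with ∈-cartesianProduct⁻ 𝓕 𝓖 AB∈
    ... | A∈ , B∈ with shifted-profile shifted cross A∈ B∈
    ...   | s , s≤n , s+t≤ = ∈-blocks 1≤t s≤n s+t≤ (All.lookup unif𝓕 A∈) (All.lookup unif𝓖 B∈)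

  upper-bound : 1 ≤ t → (𝓕 𝓖 : Family n) → Admissible n a b t 𝓕 𝓖 →
    length 𝓕 * length 𝓖 ≤ n ^ 3 * M n a b t
  upper-bound 1≤t 𝓕 𝓖 adm with compress (suc (weightSum 𝓕)) 𝓕 𝓖 ≤-refl adm
  ... | 𝓕′ , 𝓖′ , adm′ , shifted , ∣𝓕′∣≡ , ∣𝓖′∣≡ =
    subst₂ (λ p q → p * q ≤ n ^ 3 * M n a b t) ∣𝓕′∣≡ ∣𝓖′∣≡ (shifted-upper 1≤t adm′ shifted)

  summand-realised : ∀ s u v → s ≤ n →
    Σ (Family n) λ 𝓕 → Σ (Family n) λ 𝓖 → Admissible n a b t 𝓕 𝓖 × summand s u v ≤ length 𝓕 * length 𝓖
  summand-realised s u v s≤n with (s + t) ≤ᵇ (u + v) in s+t≤ᵇ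
  ... | false = [] , [] , ([] , [] , [] , [] , λ ()) , z≤n
  ... | true  = Slice n s u a , Slice n s v b ,
    (Slice-unique n s u a , Slice-unique n s v b ,
     All.tabulate (proj₂ ∘ ∈-Slice⁻ n s u a) , All.tabulate (proj₂ ∘ ∈-Slice⁻ n s v b) ,
     Slice-crossInt n s u v a b t (≤ᵇ⇒≤ (s + t) (u + v) (subst T (sym s+t≤ᵇ) _))) ,
    ≤-reflexive (sym (length-Slice*Slice s u v s≤n))

  lower-bound : Σ (Family n) λ 𝓕 → Σ (Family n) λ 𝓖 →
    Admissible n a b t 𝓕 𝓖 × M n a b t ≤ length 𝓕 * length 𝓖
  lower-bound with maxList-attained summands
  ... | inj₁ M≡0 = [] , [] , ([] , [] , [] , [] , λ ()) , ≤-reflexive M≡0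
  ... | inj₂ (x , x∈ , M≡x) with ∈-concatMap⁻′ _ (range1 n) x∈
  ...   | s , s∈ , x∈ₛ with ∈-concatMap⁻′ _ (range1 n) x∈ₛ
  ...     | u , _ , x∈ᵤ with ∈-map⁻ (summand s u) x∈ᵤ
  ...       | v , _ , refl with summand-realised s u v (∈-range1⁻ s∈)
  ...         | 𝓕 , 𝓖 , adm , summand≤ =
    𝓕 , 𝓖 , adm , subst (_≤ length 𝓕 * length 𝓖) (sym M≡x) summand≤

proposition2 : (n : ℕ) (a b : ℤ) (t : ℕ) → 1 ≤ n → 1 ≤ t →
    -- M ≤ N_prod(n,a,b,t)
    Σ (Family n) (λ 𝓕 → Σ (Family n) (λ 𝓖 →
      Admissible n a b t 𝓕 𝓖 × M n a b t ≤ length 𝓕 * length 𝓖))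
    ×
    -- N_prod(n,a,b,t) ≤ n^3 · M
    ((𝓕 𝓖 : Family n) → Admissible n a b t 𝓕 𝓖 →
      length 𝓕 * length 𝓖 ≤ n ^ 3 * M n a b t)
proposition2 n a b t _ 1≤t = lower-bound , upper-bound 1≤t
  where open Counting n a b t
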